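{- For every AC algorithm that is not chordal, there exist an input partition and a time $t$ such that the aggregated graph $G_t$ contains an induced cycle of length $4$, one of whose edges is the edge added by the negatively answered query that transformed $G_{t-1}$ into $G_t$.
   Context: AC algorithm: on a finite set $S$ with an unknown set partition, it adaptively asks an oracle whether two items are in the same block. Aggregated graphs: $G_0$ is the edgeless graph on $S$; each query concerns two distinct non-adjacent vertices $x,y$ of the current aggregated graph; a negative answer adds the edge $xy$; a positive answer merges $x,y$ into one vertex adjacent to all their neighbours, labelled by the union of their labels. The algorithm stops when the aggregated graph is complete. An AC algorithm is chordal if for every input partition every aggregated graph is chordal (all induced cycles have length $3$). -}

module Defs where

open import Data.Nat using (ℕ; zero; suc; _≤_)
open import Data.Fin using (Fin; toℕ)
open import Data.Fin.Properties using (_≟_)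
open import Data.Bool using (Bool; true; false)
open import Data.List using (List; []; _∷_; _++_)
open import Data.List.Membership.Propositional using (_∈_)
open import Data.Maybe using (Maybe; just; nothing)
open import Data.Product using (_×_; _,_; ∃; ∃-syntax)
open import Data.Sum using (_⊎_)
open import Relation.Nullary using (¬_; does)
open import Relation.Binary.PropositionalEquality using (_≡_; _≢_)

-- The ground set S is Fin n.
-- A record of one query: the two queried items and the oracle's answer
-- (true = "same block", false = "different blocks").
Record : ℕ → Set
Record n = Fin n × Fin n × Bool

History : ℕ → Set
History n = List (Record n)

-- An input set partition of S, given by a block-labelling function:
-- x and y lie in the same block iff they receive the same label.
Partition : ℕ → Set
Partition n = Fin n → Fin n

answer : ∀ {n} → Partition n → Fin n → Fin n → Bool
answer p x y = does (p x ≟ p y)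

-- Vertices are the classes of the relation Merged h (the equivalence
-- closure of the positively answered queries); the label of a vertex is
-- its class.  Two vertices are adjacent iff some negatively answered query
-- joins a member of one to a member of the other (merging a vertex makes it
-- adjacent to all neighbours of both merged vertices).
data Merged {n} (h : History n) : Fin n → Fin n → Set where
  m-refl  : ∀ {x} → Merged h x x
  m-step  : ∀ {x y} → (x , y , true) ∈ h → Merged h x y
  m-sym   : ∀ {x y} → Merged h x y → Merged h y x
  m-trans : ∀ {x y z} → Merged h x y → Merged h y z → Merged h x z

Adj : ∀ {n} → History n → Fin n → Fin n → Set
Adj h x y = ∃[ a ] ∃[ b ] (Merged h x a × Merged h y b ×
              ((a , b , false) ∈ h ⊎ (b , a , false) ∈ h))

Complete : ∀ {n} → History n → Set
Complete h = ∀ x y → ¬ Merged h x y → Adj h x y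

-- An adaptive strategy: from the history so far, either stop (nothing) or
-- ask about the vertices containing x and y (just (x , y)).
Strategy : ℕ → Set
Strategy n = History n → Maybe (Fin n × Fin n)

step : ∀ {n} → Strategy n → Partition n → History n → History n
step s p h with s h
... | nothing        = h
... | just (x , y)   = h ++ ((x , y , answer p x y) ∷ [])

run : ∀ {n} → Strategy n → Partition n → ℕ → History n
run s p zero    = []
run s p (suc t) = step s p (run s p t)

record AC (n : ℕ) : Set where
  field
    strategy  : Strategy n
    stopsIff₁ : ∀ p t → strategy (run strategy p t) ≡ nothing →
                Complete (run strategy p t)
    stopsIff₂ : ∀ p t → Complete (run strategy p t) →
                strategy (run strategy p t) ≡ nothing
    validQ    : ∀ p t x y → strategy (run strategy p t) ≡ just (x , y) →
                ¬ Merged (run strategy p t) x y × ¬ Adj (run strategy p t) x y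
open AC public

CycAdj : (k : ℕ) → Fin k → Fin k → Set
CycAdj k i j = suc (toℕ i) ≡ toℕ j ⊎ suc (toℕ j) ≡ toℕ i
             ⊎ (toℕ i ≡ 0 × suc (toℕ j) ≡ k) ⊎ (toℕ j ≡ 0 × suc (toℕ i) ≡ k)

InducedCycle : ∀ {n} → History n → (k : ℕ) → (Fin k → Fin n) → Set
InducedCycle h k v =
  (∀ i j → i ≢ j → ¬ Merged h (v i) (v j)) ×
  (∀ i j → i ≢ j → CycAdj k i j → Adj h (v i) (v j)) ×
  (∀ i j → i ≢ j → Adj h (v i) (v j) → CycAdj k i j)

ChordalGraph : ∀ {n} → History n → Set
ChordalGraph {n} h = ∀ k → 4 ≤ k → (v : Fin k → Fin n) → ¬ InducedCycle h k v

Chordal : ∀ {n} → AC n → Set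
Chordal A = ∀ p t → ChordalGraph (run (strategy A) p t)

-- Suppose that no negatively answered query ever creates an induced square having the new edge as a side;
-- then every aggregated graph is chordal.
--
-- Induced cycles of length k ≥ 5 cannot occur. Take the partition whose blocks are the current vertices:
-- from then on every query is answered negatively, and each new edge either leaves the cycle induced or
-- is a chord splitting it into two induced cycles through the new edge, one of length ≥ 4. Length 4 is
-- excluded, so an induced cycle of length ≥ 5 persists until the run stops; but the final graph is complete.
--
-- Induced squares cannot occur either, by induction on time. A square created by a negative query
-- contains the new edge as a side. A square created by merging x and y has a corner containing both;
-- in the previous graph either x or y closes the other three corners into a square, or x b c d y is an
-- induced path, and answering the same query negatively instead closes it into an induced pentagon.
--
-- Constructively, the conclusion is decidable: partitions and vertices range over finite sets, and since no
-- pair of items is queried twice, pigeonhole puts every query before time n². Hence the refutation of its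
-- negation yields a witness.

{-# OPTIONS --safe #-}
module Submission where

open import Defs
open import Data.Bool using (true; false; if_then_else_)
import Data.Bool.Properties as Boolₚ
open import Data.Empty using (⊥-elim)
open import Data.Fin as Fin using (Fin; zero; suc; toℕ)
open import Data.Fin.Properties using (_≟_; toℕ<n)
import Data.Fin.Properties as Finₚ
open import Data.List using ([]; _∷_; _∷ʳ_)
open import Data.List.Membership.Propositional using (_∈_)
open import Data.List.Membership.Propositional.Properties using (∈-++⁻; ∈-++⁺ʳ)
open import Data.List.Relation.Binary.Permutation.Propositional using (↭-sym)
open import Data.List.Relation.Binary.Permutation.Propositional.Properties using (∷↭∷ʳ)
open import Data.List.Relation.Binary.Subset.Propositional using (_⊆_)
open import Data.List.Relation.Binary.Subset.Propositional.Properties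
  using (⊆-reflexive-↭; xs⊆xs++ys; xs⊆x∷xs)
open import Data.List.Relation.Unary.Any using (here; there)
open import Data.Maybe using (just; nothing)
import Data.Maybe.Properties as Maybeₚ
open import Data.Nat as ℕ using (ℕ; zero; suc; z≤n; s≤s; _<_; _≤_; _+_; _*_)
open import Data.Nat.DivMod using (_mod_; m<n⇒m%n≡m)
open import Data.Nat.Properties
  using ( suc-injective; 0≢1+n; +-comm; ≤-refl; ≤-trans; <-irrefl; <-trans; ≤-<-trans; <-cmp; <⇒≢; <⇒≤
        ; ≤∧≢⇒<; ≮⇒≥; n<1+n; n≤1+n; m≤n⇒m<n∨m≡n; m≤n⇒m≤o+n; m≤n⇒∃[o]m+o≡n; m+n≮m )
open import Data.Product using (_×_; _,_; ∃; ∃-syntax; proj₁; proj₂; uncurry)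
import Data.Product.Properties as Productₚ
open import Data.Sum as Sum using (_⊎_; inj₁; inj₂; [_,_]′)
open import Data.Unit using (⊤; tt)
import Data.Vec.Functional as V
open import Function using (id; _∘_; case_of_)
open import Relation.Binary.Definitions using (DecidableEquality; tri<; tri≈; tri>)
open import Relation.Binary.PropositionalEquality
open import Relation.Nullary using (¬_; Dec; yes; no; does)
open import Relation.Nullary.Decidable
  using ( _×-dec_; _⊎-dec_; _→-dec_; ¬?; True; False; toWitness; toWitnessFalse
        ; dec-true; dec-false; decidable-stable )
import Relation.Nullary.Decidable as Dec

-- Aggregated graphs of histories

module _ {n : ℕ} where

  Edge : History n → Fin n → Fin n → Set
  Edge h a b = (a , b , false) ∈ h ⊎ (b , a , false) ∈ h

  Spans : History n → Fin n → Fin n → Fin n → Fin n → Set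
  Spans h x y u w = (Merged h u x × Merged h w y) ⊎ (Merged h u y × Merged h w x)

  Merged-mono : ∀ {h h' : History n} → h ⊆ h' → ∀ {x y} → Merged h x y → Merged h' x y
  Merged-mono h⊆h' m-refl          = m-refl
  Merged-mono h⊆h' (m-step r∈h)    = m-step (h⊆h' r∈h)
  Merged-mono h⊆h' (m-sym m)       = m-sym (Merged-mono h⊆h' m)
  Merged-mono h⊆h' (m-trans m₁ m₂) = m-trans (Merged-mono h⊆h' m₁) (Merged-mono h⊆h' m₂)

  Adj-mono : ∀ {h h' : History n} → h ⊆ h' → ∀ {x y} → Adj h x y → Adj h' x y
  Adj-mono h⊆h' (a , b , xa , yb , inj₁ e) = a , b , Merged-mono h⊆h' xa , Merged-mono h⊆h' yb , inj₁ (h⊆h' e)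
  Adj-mono h⊆h' (a , b , xa , yb , inj₂ e) = a , b , Merged-mono h⊆h' xa , Merged-mono h⊆h' yb , inj₂ (h⊆h' e)

  Adj-sym : ∀ {h : History n} {x y} → Adj h x y → Adj h y x
  Adj-sym (a , b , xa , yb , inj₁ e) = b , a , yb , xa , inj₂ e
  Adj-sym (a , b , xa , yb , inj₂ e) = b , a , yb , xa , inj₁ e

  Adj-resp-Merged : ∀ {h : History n} {x y x' y'} → Merged h x x' → Merged h y y' → Adj h x y → Adj h x' y'
  Adj-resp-Merged xx' yy' (a , b , xa , yb , e) = a , b , m-trans (m-sym xx') xa , m-trans (m-sym yy') yb , e

  Edge⇒Adj : ∀ {h : History n} {a b} → Edge h a b → Adj h a b
  Edge⇒Adj e = _ , _ , m-refl , m-refl , e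

  Spans-sym : ∀ {h : History n} {x y u w} → Spans h x y u w → Spans h x y w u
  Spans-sym (inj₁ (ux , wy)) = inj₂ (wy , ux)
  Spans-sym (inj₂ (uy , wx)) = inj₁ (wx , uy)

  Spans-mono : ∀ {h h' : History n} → h ⊆ h' → ∀ {x y u w} → Spans h x y u w → Spans h' x y u w
  Spans-mono h⊆h' (inj₁ (ux , wy)) = inj₁ (Merged-mono h⊆h' ux , Merged-mono h⊆h' wy)
  Spans-mono h⊆h' (inj₂ (uy , wx)) = inj₂ (Merged-mono h⊆h' uy , Merged-mono h⊆h' wx)

  relabel : (Fin n → Fin n) → Fin n → Fin n → Fin n → Fin n
  relabel f a b z = if does (f z ≟ f a) then f b else f z

  module _ (f : Fin n → Fin n) (a b : Fin n) where

    relabel-old : ∀ {z} → f z ≡ f a → relabel f a b z ≡ f b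
    relabel-old {z} e with f z ≟ f a
    ... | yes _ = refl
    ... | no ¬e = ⊥-elim (¬e e)

    relabel-other : ∀ {z} → f z ≢ f a → relabel f a b z ≡ f z
    relabel-other {z} ¬e with f z ≟ f a
    ... | yes e = ⊥-elim (¬e e)
    ... | no _  = refl

    relabel-cong : ∀ {u w} → f u ≡ f w → relabel f a b u ≡ relabel f a b w
    relabel-cong {u} {w} e with f u ≟ f a | f w ≟ f a
    ... | yes _  | yes _  = refl
    ... | yes ua | no ¬wa = ⊥-elim (¬wa (trans (sym e) ua))
    ... | no ¬ua | yes wa = ⊥-elim (¬ua (trans e wa))
    ... | no _   | no _   = e

    relabel-merges : relabel f a b a ≡ relabel f a b b
    relabel-merges = trans (relabel-old refl) (sym (merge (f b ≟ f a)))
      where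
      merge : Dec (f b ≡ f a) → relabel f a b b ≡ f b
      merge (yes ba) = relabel-old ba
      merge (no ¬ba) = relabel-other ¬ba

    relabel-≡ : ∀ {u w} → relabel f a b u ≡ relabel f a b w →
                f u ≡ f w ⊎ (f u ≡ f a × f b ≡ f w) ⊎ (f u ≡ f b × f a ≡ f w)
    relabel-≡ {u} {w} e with f u ≟ f a | f w ≟ f a
    ... | yes ua | yes wa = inj₁ (trans ua (sym wa))
    ... | yes ua | no _   = inj₂ (inj₁ (ua , e))
    ... | no _   | yes wa = inj₂ (inj₂ (e , sym wa))
    ... | no _   | no _   = inj₁ e

  Merged-∷ : ∀ {h : History n} {r x y} → Merged h x y → Merged (r ∷ h) x y
  Merged-∷ = Merged-mono (xs⊆x∷xs _ _)

  rep : History n → Fin n → Fin n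
  rep []                    = id
  rep ((a , b , true)  ∷ h) = relabel (rep h) a b
  rep ((a , b , false) ∷ h) = rep h

  rep-record : ∀ h {x y} → (x , y , true) ∈ h → rep h x ≡ rep h y
  rep-record ((a , b , true)  ∷ h) (here refl) = relabel-merges (rep h) a b
  rep-record ((a , b , true)  ∷ h) (there r)   = relabel-cong (rep h) a b (rep-record h r)
  rep-record ((a , b , false) ∷ h) (there r)   = rep-record h r

  rep-complete : ∀ h {x y} → Merged h x y → rep h x ≡ rep h y
  rep-complete h m-refl          = refl
  rep-complete h (m-step r)      = rep-record h r
  rep-complete h (m-sym m)       = sym (rep-complete h m)
  rep-complete h (m-trans m₁ m₂) = trans (rep-complete h m₁) (rep-complete h m₂)

  rep-sound : ∀ h {x y} → rep h x ≡ rep h y → Merged h x y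
  rep-sound []                    refl = m-refl
  rep-sound ((a , b , true) ∷ h)  e    with relabel-≡ (rep h) a b e
  ... | inj₁ uw               = Merged-∷ (rep-sound h uw)
  ... | inj₂ (inj₁ (ua , bw)) =
    m-trans (Merged-∷ (rep-sound h ua)) (m-trans (m-step (here refl)) (Merged-∷ (rep-sound h bw)))
  ... | inj₂ (inj₂ (ub , aw)) =
    m-trans (Merged-∷ (rep-sound h ub)) (m-trans (m-sym (m-step (here refl))) (Merged-∷ (rep-sound h aw)))
  rep-sound ((a , b , false) ∷ h) e    = Merged-∷ (rep-sound h e)

  Merged? : ∀ h x y → Dec (Merged h x y)
  Merged? h x y = Dec.map′ (rep-sound h) (rep-complete h) (rep h x ≟ rep h y)

  _≟-record_ : DecidableEquality (Record n)
  _≟-record_ = Productₚ.≡-dec _≟_ (Productₚ.≡-dec _≟_ Boolₚ._≟_)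

  Edge? : ∀ h a b → Dec (Edge h a b)
  Edge? h a b = ((a , b , false) ∈? h) ⊎-dec ((b , a , false) ∈? h)
    where open import Data.List.Membership.DecPropositional _≟-record_ using (_∈?_)

  Adj? : ∀ h x y → Dec (Adj h x y)
  Adj? h x y = Finₚ.any? λ a → Finₚ.any? λ b → Merged? h x a ×-dec Merged? h y b ×-dec Edge? h a b

  module _ {h : History n} {x y : Fin n} where

    ∈-∷ʳ⁻ : ∀ {b r} → r ∈ h ∷ʳ (x , y , b) → r ∈ h ⊎ r ≡ (x , y , b)
    ∈-∷ʳ⁻ r∈ with ∈-++⁻ h r∈
    ... | inj₁ r∈h        = inj₁ r∈h
    ... | inj₂ (here r≡) = inj₂ r≡

    ⊆-∷ʳ : ∀ {b} → h ⊆ h ∷ʳ (x , y , b)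
    ⊆-∷ʳ = xs⊆xs++ys h _

    ∷ʳ⊆∷ : ∀ {b} → h ∷ʳ (x , y , b) ⊆ (x , y , b) ∷ h
    ∷ʳ⊆∷ = ⊆-reflexive-↭ (↭-sym (∷↭∷ʳ _ h))

    Merged-∷ʳ-negative : ∀ {u w} → Merged (h ∷ʳ (x , y , false)) u w → Merged h u w
    Merged-∷ʳ-negative m = rep-sound h (rep-complete (_ ∷ h) (Merged-mono ∷ʳ⊆∷ m))

    Merged-∷ʳ-positive : ∀ {u w} → Merged (h ∷ʳ (x , y , true)) u w → Merged h u w ⊎ Spans h x y u w
    Merged-∷ʳ-positive m with relabel-≡ (rep h) x y (rep-complete (_ ∷ h) (Merged-mono ∷ʳ⊆∷ m))
    ... | inj₁ uw               = inj₁ (rep-sound h uw)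
    ... | inj₂ (inj₁ (ux , yw)) = inj₂ (inj₁ (rep-sound h ux , rep-sound h (sym yw)))
    ... | inj₂ (inj₂ (uy , xw)) = inj₂ (inj₂ (rep-sound h uy , rep-sound h (sym xw)))

    Edge-∷ʳ-positive : ∀ {a b} → Edge (h ∷ʳ (x , y , true)) a b → Edge h a b
    Edge-∷ʳ-positive (inj₁ e) with ∈-∷ʳ⁻ e
    ... | inj₁ e' = inj₁ e'
    Edge-∷ʳ-positive (inj₂ e) with ∈-∷ʳ⁻ e
    ... | inj₁ e' = inj₂ e'

    Adj-∷ʳ-negative : ∀ {u w} → Adj (h ∷ʳ (x , y , false)) u w → Adj h u w ⊎ Spans h x y u w
    Adj-∷ʳ-negative (a , b , ua , wb , inj₁ e) with ∈-∷ʳ⁻ e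
    ... | inj₁ e'   = inj₁ (a , b , Merged-∷ʳ-negative ua , Merged-∷ʳ-negative wb , inj₁ e')
    ... | inj₂ refl = inj₂ (inj₁ (Merged-∷ʳ-negative ua , Merged-∷ʳ-negative wb))
    Adj-∷ʳ-negative (a , b , ua , wb , inj₂ e) with ∈-∷ʳ⁻ e
    ... | inj₁ e'   = inj₁ (a , b , Merged-∷ʳ-negative ua , Merged-∷ʳ-negative wb , inj₂ e')
    ... | inj₂ refl = inj₂ (inj₂ (Merged-∷ʳ-negative ua , Merged-∷ʳ-negative wb))

    Spans⇒Adj-∷ʳ-negative : ∀ {u w} → Spans h x y u w → Adj (h ∷ʳ (x , y , false)) u w
    Spans⇒Adj-∷ʳ-negative (inj₁ (ux , wy)) =
      x , y , Merged-mono ⊆-∷ʳ ux , Merged-mono ⊆-∷ʳ wy , inj₁ (∈-++⁺ʳ h (here refl))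
    Spans⇒Adj-∷ʳ-negative (inj₂ (uy , wx)) =
      y , x , Merged-mono ⊆-∷ʳ uy , Merged-mono ⊆-∷ʳ wx , inj₂ (∈-++⁺ʳ h (here refl))

  Loopless : History n → Set
  Loopless h = ∀ {u w} → Adj h u w → ¬ Merged h u w

  Loopless-∷ʳ-negative : ∀ {h x y} → Loopless h → ¬ Merged h x y → Loopless (h ∷ʳ (x , y , false))
  Loopless-∷ʳ-negative loopless ¬xy u∼w u≈w with Adj-∷ʳ-negative u∼w | Merged-∷ʳ-negative u≈w
  ... | inj₁ u∼w′             | u≈w′ = loopless u∼w′ u≈w′
  ... | inj₂ (inj₁ (ux , wy)) | u≈w′ = ¬xy (m-trans (m-sym ux) (m-trans u≈w′ wy))
  ... | inj₂ (inj₂ (uy , wx)) | u≈w′ = ¬xy (m-trans (m-sym wx) (m-trans (m-sym u≈w′) uy))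

  Loopless-∷ʳ-positive : ∀ {h x y} → Loopless h → ¬ Adj h x y → Loopless (h ∷ʳ (x , y , true))
  Loopless-∷ʳ-positive loopless ¬xy (a , b , ua , wb , e) u≈w
    with Merged-∷ʳ-positive (m-trans (m-sym ua) (m-trans u≈w wb))
  ... | inj₁ a≈b              = loopless (Edge⇒Adj (Edge-∷ʳ-positive e)) a≈b
  ... | inj₂ (inj₁ (ax , by)) = ¬xy (Adj-resp-Merged ax by (Edge⇒Adj (Edge-∷ʳ-positive e)))
  ... | inj₂ (inj₂ (ay , bx)) = ¬xy (Adj-sym (Adj-resp-Merged ay bx (Edge⇒Adj (Edge-∷ʳ-positive e))))

-- Positions on a cycle

cycAdj? : ∀ k (i j : Fin k) → Dec (CycAdj k i j)
cycAdj? k i j = (suc (toℕ i) ℕ.≟ toℕ j) ⊎-dec (suc (toℕ j) ℕ.≟ toℕ i)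
  ⊎-dec ((toℕ i ℕ.≟ 0) ×-dec (suc (toℕ j) ℕ.≟ k)) ⊎-dec ((toℕ j ℕ.≟ 0) ×-dec (suc (toℕ i) ℕ.≟ k))

CycAdj-sym : ∀ {k i j} → CycAdj k i j → CycAdj k j i
CycAdj-sym (inj₁ e)               = inj₂ (inj₁ e)
CycAdj-sym (inj₂ (inj₁ e))        = inj₁ e
CycAdj-sym (inj₂ (inj₂ (inj₁ e))) = inj₂ (inj₂ (inj₂ e))
CycAdj-sym (inj₂ (inj₂ (inj₂ e))) = inj₂ (inj₂ (inj₁ e))

consecutive : ∀ {k i j} {c : True (cycAdj? k i j)} → CycAdj k i j
consecutive {c = c} = toWitness c

not-consecutive : ∀ {k i j} {c : False (cycAdj? k i j)} → ¬ CycAdj k i j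
not-consecutive {c = c} = toWitnessFalse c

next : ℕ → ℕ → ℕ
next k i with suc i ℕ.≟ k
... | yes _ = 0
... | no _  = suc i

next-last : ∀ {k i} → suc i ≡ k → next k i ≡ 0
next-last {k} {i} e with suc i ℕ.≟ k
... | yes _  = refl
... | no ¬e = ⊥-elim (¬e e)

next-inner : ∀ {k i} → suc i < k → next k i ≡ suc i
next-inner {k} {i} lt with suc i ℕ.≟ k
... | yes e = ⊥-elim (<-irrefl e lt)
... | no _  = refl

next-cases : ∀ {k i} → i < k → (suc i ≡ k × next k i ≡ 0) ⊎ (suc i < k × next k i ≡ suc i)
next-cases i<k with m≤n⇒m<n∨m≡n i<k
... | inj₁ lt = inj₂ (lt , next-inner lt)
... | inj₂ e  = inj₁ (e , next-last e)

next-< : ∀ {k i} → i < k → next k i < k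
next-< {k} i<k with next-cases i<k
... | inj₁ (refl , e) = subst (_< k) (sym e) (s≤s z≤n)
... | inj₂ (lt , e)   = subst (_< k) (sym e) lt

next-injective : ∀ {k i j} → i < k → j < k → next k i ≡ next k j → i ≡ j
next-injective i<k j<k e with next-cases i<k | next-cases j<k
... | inj₁ (ik , _)  | inj₁ (jk , _)  = suc-injective (trans ik (sym jk))
... | inj₁ (_ , ni)  | inj₂ (_ , nj)  = ⊥-elim (0≢1+n (trans (sym ni) (trans e nj)))
... | inj₂ (_ , ni)  | inj₁ (_ , nj)  = ⊥-elim (0≢1+n (trans (sym nj) (trans (sym e) ni)))
... | inj₂ (_ , ni)  | inj₂ (_ , nj)  = suc-injective (trans (sym ni) (trans e nj))

next-≡⁺ : ∀ {k i j} → i < k → j < k → suc i ≡ j ⊎ (j ≡ 0 × suc i ≡ k) → next k i ≡ j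
next-≡⁺ i<k j<k (inj₁ refl)        = next-inner j<k
next-≡⁺ i<k j<k (inj₂ (refl , ik)) = next-last ik

next-≡⁻ : ∀ {k i j} → i < k → next k i ≡ j → suc i ≡ j ⊎ (j ≡ 0 × suc i ≡ k)
next-≡⁻ i<k refl with next-cases i<k
... | inj₁ (ik , e) = inj₂ (e , ik)
... | inj₂ (_ , e)  = inj₁ (sym e)

Consecutive : ℕ → ℕ → ℕ → Set
Consecutive k i j = next k i ≡ j ⊎ next k j ≡ i

module _ {k : ℕ} (i j : Fin k) where

  CycAdj⇒Consecutive : CycAdj k i j → Consecutive k (toℕ i) (toℕ j)
  CycAdj⇒Consecutive (inj₁ e)               = inj₁ (next-≡⁺ (toℕ<n i) (toℕ<n j) (inj₁ e))
  CycAdj⇒Consecutive (inj₂ (inj₁ e))        = inj₂ (next-≡⁺ (toℕ<n j) (toℕ<n i) (inj₁ e))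
  CycAdj⇒Consecutive (inj₂ (inj₂ (inj₁ e))) = inj₂ (next-≡⁺ (toℕ<n j) (toℕ<n i) (inj₂ e))
  CycAdj⇒Consecutive (inj₂ (inj₂ (inj₂ e))) = inj₁ (next-≡⁺ (toℕ<n i) (toℕ<n j) (inj₂ e))

  Consecutive⇒CycAdj : Consecutive k (toℕ i) (toℕ j) → CycAdj k i j
  Consecutive⇒CycAdj (inj₁ e) with next-≡⁻ (toℕ<n i) e
  ... | inj₁ e' = inj₁ e'
  ... | inj₂ e' = inj₂ (inj₂ (inj₂ e'))
  Consecutive⇒CycAdj (inj₂ e) with next-≡⁻ (toℕ<n j) e
  ... | inj₁ e' = inj₂ (inj₁ e')
  ... | inj₂ e' = inj₂ (inj₂ (inj₁ e'))

toℕ-mod : ∀ {i k} → i < suc k → toℕ (i mod suc k) ≡ i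
toℕ-mod {i} {k} i<k = trans (Finₚ.toℕ-fromℕ< _) (m<n⇒m%n≡m i<k)

-- ∀ i j → i < j → P i j, laid out row by row so that a table of pairs can be written as a term.
OrderedPairs : ∀ {k} → (Fin k → Fin k → Set) → Set
OrderedPairs {zero}  P = ⊤
OrderedPairs {suc k} P = (∀ j → P zero (suc j)) × OrderedPairs (λ i j → P (suc i) (suc j))

OrderedPairs-< : ∀ {k} {P : Fin k → Fin k → Set} → OrderedPairs P → ∀ {i j} → i Fin.< j → P i j
OrderedPairs-< (first , rest) {i = zero}  {j = suc j} _         = first j
OrderedPairs-< (first , rest) {i = suc i} {j = suc j} (s≤s i<j) = OrderedPairs-< rest i<j

-- Induced cycles

module _ {n : ℕ} where

  record CyclePair (h : History n) (k : ℕ) (v : Fin k → Fin n) (i j : Fin k) : Set where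
    constructor cyclePair
    field
      distinct  : ¬ Merged h (v i) (v j)
      adjacent  : CycAdj k i j → Adj h (v i) (v j)
      chordless : Adj h (v i) (v j) → CycAdj k i j

  CyclePair-sym : ∀ {h k v i j} → CyclePair h k v i j → CyclePair h k v j i
  CyclePair-sym (cyclePair d a c) = cyclePair (d ∘ m-sym) (Adj-sym ∘ a ∘ CycAdj-sym) (CycAdj-sym ∘ c ∘ Adj-sym)

  InducedCycle-fromPairs : ∀ {h k v} → OrderedPairs (CyclePair h k v) → InducedCycle h k v
  InducedCycle-fromPairs {h} {k} {v} ps =
    (λ i j i≢j → CyclePair.distinct (pair i j i≢j)) ,
    (λ i j i≢j → CyclePair.adjacent (pair i j i≢j)) ,
    (λ i j i≢j → CyclePair.chordless (pair i j i≢j))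
    where
    pair : ∀ i j → i ≢ j → CyclePair h k v i j
    pair i j i≢j with Finₚ.<-cmp i j
    ... | tri< i<j _ _ = OrderedPairs-< ps i<j
    ... | tri≈ _ i≡j _ = ⊥-elim (i≢j i≡j)
    ... | tri> _ _ j<i = CyclePair-sym (OrderedPairs-< ps j<i)

  -- The condition on the positions is discharged by evaluation when k, i and j are numerals.
  edge : ∀ {h k v i j} {c : True (cycAdj? k i j)} →
         ¬ Merged h (v i) (v j) → Adj h (v i) (v j) → CyclePair h k v i j
  edge {c = c} ¬m a = cyclePair ¬m (λ _ → a) (λ _ → toWitness c)

  non-edge : ∀ {h k v i j} {c : False (cycAdj? k i j)} →
             ¬ Merged h (v i) (v j) → ¬ Adj h (v i) (v j) → CyclePair h k v i j
  non-edge {c = c} ¬m ¬a = cyclePair ¬m (⊥-elim ∘ toWitnessFalse c) (⊥-elim ∘ ¬a)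

  record Square (h : History n) (a b c d : Fin n) : Set where
    field
      a≠b : ¬ Merged h a b
      a≠c : ¬ Merged h a c
      a≠d : ¬ Merged h a d
      b≠c : ¬ Merged h b c
      b≠d : ¬ Merged h b d
      c≠d : ¬ Merged h c d
      a∼b : Adj h a b
      b∼c : Adj h b c
      c∼d : Adj h c d
      d∼a : Adj h d a
      a≁c : ¬ Adj h a c
      b≁d : ¬ Adj h b d

  module _ {h : History n} {a b c d : Fin n} (sq : Square h a b c d) where
    open Square sq

    Square-rotate : Square h b c d a
    Square-rotate = record
      { a≠b = b≠c ; a≠c = b≠d ; a≠d = a≠b ∘ m-sym
      ; b≠c = c≠d ; b≠d = a≠c ∘ m-sym ; c≠d = a≠d ∘ m-sym
      ; a∼b = b∼c ; b∼c = c∼d ; c∼d = d∼a ; d∼a = a∼b ; a≁c = b≁d ; b≁d = a≁c ∘ Adj-sym }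

    Square-reflect : Square h a d c b
    Square-reflect = record
      { a≠b = a≠d ; a≠c = a≠c ; a≠d = a≠b
      ; b≠c = c≠d ∘ m-sym ; b≠d = b≠d ∘ m-sym ; c≠d = b≠c ∘ m-sym
      ; a∼b = Adj-sym d∼a ; b∼c = Adj-sym c∼d ; c∼d = Adj-sym b∼c ; d∼a = Adj-sym a∼b
      ; a≁c = a≁c ; b≁d = b≁d ∘ Adj-sym }

    Square⇒InducedCycle : InducedCycle h 4 (a V.∷ b V.∷ c V.∷ d V.∷ V.[])
    Square⇒InducedCycle = InducedCycle-fromPairs {k = 4}
      ( (λ { zero             → edge a≠b a∼b
           ; (suc zero)       → non-edge a≠c a≁c
           ; (suc (suc zero)) → edge a≠d (Adj-sym d∼a) })
      , (λ { zero → edge b≠c b∼c ; (suc zero) → non-edge b≠d b≁d })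
      , (λ { zero → edge c≠d c∼d })
      , (λ ())
      , tt )

  InducedCycle⇒Square : ∀ {h v} → InducedCycle h 4 v →
                        Square h (v zero) (v (suc zero)) (v (suc (suc zero))) (v (suc (suc (suc zero))))
  InducedCycle⇒Square (distinct , adjacent , chordless) = record
    { a≠b = distinct _ _ (λ ()) ; a≠c = distinct _ _ (λ ()) ; a≠d = distinct _ _ (λ ())
    ; b≠c = distinct _ _ (λ ()) ; b≠d = distinct _ _ (λ ()) ; c≠d = distinct _ _ (λ ())
    ; a∼b = adjacent zero (suc zero) (λ ()) consecutive
    ; b∼c = adjacent (suc zero) (suc (suc zero)) (λ ()) consecutive
    ; c∼d = adjacent (suc (suc zero)) (suc (suc (suc zero))) (λ ()) consecutive
    ; d∼a = adjacent (suc (suc (suc zero))) zero (λ ()) consecutive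
    ; a≁c = not-consecutive ∘ chordless zero (suc (suc zero)) (λ ())
    ; b≁d = not-consecutive ∘ chordless (suc zero) (suc (suc (suc zero))) (λ ()) }

  -- The same notion with positions in ℕ, so that rotations and prefixes need no Fin arithmetic.
  record Cycle (h : History n) (k : ℕ) (c : ℕ → Fin n) : Set where
    field
      distinct  : ∀ {i j} → i < k → j < k → i ≢ j → ¬ Merged h (c i) (c j)
      adjacent  : ∀ {i j} → i < k → j < k → i ≢ j → Consecutive k i j → Adj h (c i) (c j)
      chordless : ∀ {i j} → i < k → j < k → i ≢ j → Adj h (c i) (c j) → Consecutive k i j
  open Cycle

  Cycle⇒InducedCycle : ∀ {h k c} → Cycle h k c → InducedCycle h k (c ∘ toℕ)
  Cycle⇒InducedCycle C =
    (λ i j i≢j → distinct C (toℕ<n i) (toℕ<n j) (i≢j ∘ Finₚ.toℕ-injective)) ,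
    (λ i j i≢j → adjacent C (toℕ<n i) (toℕ<n j) (i≢j ∘ Finₚ.toℕ-injective) ∘ CycAdj⇒Consecutive i j) ,
    (λ i j i≢j → Consecutive⇒CycAdj i j ∘ chordless C (toℕ<n i) (toℕ<n j) (i≢j ∘ Finₚ.toℕ-injective))

  InducedCycle⇒Cycle : ∀ {h k v} → InducedCycle h (suc k) v → Cycle h (suc k) (λ i → v (i mod suc k))
  InducedCycle⇒Cycle {h} {k} {v} (distinct′ , adjacent′ , chordless′) = record
    { distinct  = λ i<k j<k i≢j → distinct′ _ _ (fin-≢ i<k j<k i≢j)
    ; adjacent  = λ i<k j<k i≢j → adjacent′ _ _ (fin-≢ i<k j<k i≢j) ∘ Consecutive⇒CycAdj _ _
                                    ∘ subst₂ (Consecutive (suc k)) (sym (toℕ-mod i<k)) (sym (toℕ-mod j<k))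
    ; chordless = λ i<k j<k i≢j → subst₂ (Consecutive (suc k)) (toℕ-mod i<k) (toℕ-mod j<k)
                                    ∘ CycAdj⇒Consecutive _ _ ∘ chordless′ _ _ (fin-≢ i<k j<k i≢j) }
    where
    fin-≢ : ∀ {i j} → i < suc k → j < suc k → i ≢ j → i mod suc k ≢ j mod suc k
    fin-≢ i<k j<k i≢j e = i≢j (trans (sym (toℕ-mod i<k)) (trans (cong toℕ e) (toℕ-mod j<k)))

  module _ {h : History n} {k : ℕ} {c : ℕ → Fin n} (C : Cycle h k c) where

    Cycle-rotate : Cycle h k (c ∘ next k)
    Cycle-rotate = record
      { distinct  = λ i<k j<k i≢j → distinct C (next-< i<k) (next-< j<k) (i≢j ∘ next-injective i<k j<k)
      ; adjacent  = λ i<k j<k i≢j → adjacent C (next-< i<k) (next-< j<k) (i≢j ∘ next-injective i<k j<k)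
                                      ∘ Sum.map (cong (next k)) (cong (next k))
      ; chordless = λ i<k j<k i≢j → Sum.map (next-injective (next-< i<k) j<k) (next-injective (next-< j<k) i<k)
                                      ∘ chordless C (next-< i<k) (next-< j<k) (i≢j ∘ next-injective i<k j<k) }

    same-position : ∀ {i j z} → i < k → j < k → Merged h (c i) z → Merged h (c j) z → i ≡ j
    same-position {i} {j} i<k j<k iz jz with i ℕ.≟ j
    ... | yes i≡j = i≡j
    ... | no i≢j  = ⊥-elim (distinct C i<k j<k i≢j (m-trans iz (m-sym jz)))

    module _ {x y : Fin n} where

      Cycle-∷ʳ-negative : (∀ {i j} → i < k → j < k → ¬ Spans h x y (c i) (c j)) →
                          Cycle (h ∷ʳ (x , y , false)) k c
      Cycle-∷ʳ-negative ¬spans = record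
        { distinct  = λ i<k j<k i≢j → distinct C i<k j<k i≢j ∘ Merged-∷ʳ-negative
        ; adjacent  = λ i<k j<k i≢j → Adj-mono ⊆-∷ʳ ∘ adjacent C i<k j<k i≢j
        ; chordless = λ i<k j<k i≢j a →
            [ chordless C i<k j<k i≢j , ⊥-elim ∘ ¬spans i<k j<k ]′ (Adj-∷ʳ-negative a) }

      Cycle-close : ∀ {j} → suc j < k → Spans h x y (c 0) (c j) → Cycle (h ∷ʳ (x , y , false)) (suc j) c
      Cycle-close {j} sj<k ends = record
        { distinct  = λ a<j b<j a≢b → distinct C (below a<j) (below b<j) a≢b ∘ Merged-∷ʳ-negative
        ; adjacent  = λ a<j b<j a≢b →
            [ edge-at a<j b<j a≢b , Adj-sym ∘ edge-at b<j a<j (a≢b ∘ sym) ]′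
        ; chordless = λ a<j b<j a≢b a∼b →
            [ Sum.map (shorten a<j b<j) (shorten b<j a<j) ∘ chordless C (below a<j) (below b<j) a≢b
            , ends-consecutive a<j b<j ]′ (Adj-∷ʳ-negative a∼b) }
        where
        below : ∀ {a} → a < suc j → a < k
        below a<j = <-trans a<j sj<k

        shorten : ∀ {a b} → a < suc j → b < suc j → next k a ≡ b → next (suc j) a ≡ b
        shorten a<j b<j e = next-≡⁺ a<j b<j (inj₁ (trans (sym (next-inner (≤-<-trans a<j sj<k))) e))

        wrap : ∀ {a b} → a ≡ j → b ≡ 0 → next (suc j) a ≡ b
        wrap refl refl = next-last refl

        edge-at : ∀ {a b} → a < suc j → b < suc j → a ≢ b → next (suc j) a ≡ b →
                  Adj (h ∷ʳ (x , y , false)) (c a) (c b)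
        edge-at a<j b<j a≢b e with next-cases a<j
        ... | inj₁ (a≡j , e₀) =
          subst₂ (λ u w → Adj _ (c u) (c w)) (sym (suc-injective a≡j)) (trans (sym e₀) e)
            (Spans⇒Adj-∷ʳ-negative (Spans-sym ends))
        ... | inj₂ (sa<sj , eₛ) = Adj-mono ⊆-∷ʳ (adjacent C (below a<j) (below b<j) a≢b
                                  (inj₁ (trans (next-inner (<-trans sa<sj sj<k)) (trans (sym eₛ) e))))

        j<k : j < k
        j<k = <-trans (n<1+n j) sj<k

        0<k : 0 < k
        0<k = ≤-<-trans z≤n sj<k

        ends-consecutive : ∀ {a b} → a < suc j → b < suc j → Spans h x y (c a) (c b) → Consecutive (suc j) a b
        ends-consecutive a<j b<j (inj₁ (ax , by)) =
          [ (λ (0x , jy) → inj₂ (wrap (same-position (below b<j) j<k by jy) (same-position (below a<j) 0<k ax 0x)))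
          , (λ (0y , jx) → inj₁ (wrap (same-position (below a<j) j<k ax jx) (same-position (below b<j) 0<k by 0y)))
          ]′ ends
        ends-consecutive a<j b<j (inj₂ (ay , bx)) = Sum.swap (ends-consecutive b<j a<j (inj₁ (bx , ay)))

  -- Rotate until the chord starts at position 0. A chord from 0 to j ≥ 3 closes the prefix c 0 … c j;
  -- a chord from 0 to 2 closes c 2 … c (k-1) c 0 instead, which after two more rotations is a prefix.
  Cycle-chord : ∀ {h k c x y} → Cycle h k c → 5 ≤ k → ∀ {i j} → i < j → j < k → ¬ Consecutive k i j →
                Spans h x y (c i) (c j) →
                ∃[ m ] ∃[ c' ] (3 ≤ m × Cycle (h ∷ʳ (x , y , false)) (suc m) c' × Spans h x y (c' 0) (c' m))
  Cycle-chord {h} {k} {c} {x} {y} C k≥5 {suc i} {suc j} (s≤s i<j) sj<k ¬ij ij =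
    Cycle-chord (Cycle-rotate C) k≥5 i<j (<-trans (n<1+n j) sj<k)
      (¬ij ∘ subst₂ (Consecutive k) next-i next-j ∘ Sum.map (cong (next k)) (cong (next k)))
      (subst₂ (λ u w → Spans h x y (c u) (c w)) (sym next-i) (sym next-j) ij)
    where
    next-i : next k i ≡ suc i
    next-i = next-inner (<-trans (s≤s i<j) sj<k)
    next-j : next k j ≡ suc j
    next-j = next-inner sj<k
  Cycle-chord C (s≤s (s≤s k≥3)) {zero} {suc zero} _ _ ¬01 _ =
    ⊥-elim (¬01 (inj₁ refl))
  Cycle-chord {h} {suc (suc k)} {c} {x} {y} C (s≤s (s≤s k≥3)) {zero} {suc (suc zero)} _ _ _ c₀c₂ =
    k , (λ i → c (next (suc (suc k)) (next (suc (suc k)) i))) , k≥3 ,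
    Cycle-close (Cycle-rotate (Cycle-rotate C)) ≤-refl c₂c₀ , c₂c₀
    where
    c₂c₀ : Spans h x y (c (next (suc (suc k)) (next (suc (suc k)) 0))) (c (next (suc (suc k)) (next (suc (suc k)) k)))
    c₂c₀ rewrite next-inner {suc (suc k)} {1} (s≤s (s≤s (≤-trans (s≤s z≤n) k≥3)))
               | next-inner {suc (suc k)} {k} ≤-refl | next-last {suc (suc k)} {suc k} refl = Spans-sym c₀c₂
  Cycle-chord {k = k} C _ {zero} {suc (suc (suc j))} _ j<k ¬0j 0j =
    suc (suc (suc j)) , _ , s≤s (s≤s (s≤s z≤n)) , Cycle-close C sj<k 0j , 0j
    where
    sj<k : suc (suc (suc (suc j))) < k
    sj<k = ≤∧≢⇒< j<k (¬0j ∘ inj₂ ∘ next-last)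

  Complete-¬Cycle : ∀ {h k c} → Complete h → 4 ≤ k → ¬ Cycle h k c
  Complete-¬Cycle complete k≥4 C with Cycle.chordless C 0<k 2<k (λ ())
                                        (complete _ _ (Cycle.distinct C 0<k 2<k (λ ())))
    where
    0<k = ≤-trans (s≤s z≤n) k≥4
    2<k = ≤-trans (s≤s (s≤s (s≤s z≤n))) k≥4
  ... | inj₁ 1≡2 = case trans (sym (next-inner (≤-trans (s≤s (s≤s z≤n)) k≥4))) 1≡2 of λ ()
  ... | inj₂ 3≡0 = case trans (sym (next-inner k≥4)) 3≡0 of λ ()

  Square-earlier : ∀ {h h' : History n} → h ⊆ h' → ∀ {a b c d} → Square h' a b c d →
                   Adj h a b → Adj h b c → Adj h c d → Adj h d a → Square h a b c d
  Square-earlier h⊆h' sq a∼b b∼c c∼d d∼a = record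
    { a≠b = a≠b ∘ Merged-mono h⊆h' ; a≠c = a≠c ∘ Merged-mono h⊆h' ; a≠d = a≠d ∘ Merged-mono h⊆h'
    ; b≠c = b≠c ∘ Merged-mono h⊆h' ; b≠d = b≠d ∘ Merged-mono h⊆h' ; c≠d = c≠d ∘ Merged-mono h⊆h'
    ; a∼b = a∼b ; b∼c = b∼c ; c∼d = c∼d ; d∼a = d∼a
    ; a≁c = a≁c ∘ Adj-mono h⊆h' ; b≁d = b≁d ∘ Adj-mono h⊆h' }
    where open Square sq hiding (a∼b; b∼c; c∼d; d∼a)

  SquareOn : History n → Fin n → Fin n → Set
  SquareOn h x y = ∃[ a ] ∃[ b ] ∃[ c ] ∃[ d ] (Square h a b c d × Merged h a x × Merged h b y)

  Square-spanning-side : ∀ {h x y a b c d} → Square h a b c d → Spans h x y a b → SquareOn h x y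
  Square-spanning-side sq (inj₁ (ax , by)) = _ , _ , _ , _ , sq , ax , by
  Square-spanning-side sq (inj₂ (ay , bx)) = _ , _ , _ , _ , Square-reflect (Square-rotate sq) , bx , ay

  module _ {h : History n} {x y : Fin n} where

    Square-∷ʳ-negative : ∀ {a b c d} → Square (h ∷ʳ (x , y , false)) a b c d →
                         Square h a b c d ⊎ SquareOn (h ∷ʳ (x , y , false)) x y
    Square-∷ʳ-negative sq
      with Adj-∷ʳ-negative (a∼b sq) | Adj-∷ʳ-negative (b∼c sq)
         | Adj-∷ʳ-negative (c∼d sq) | Adj-∷ʳ-negative (d∼a sq)
      where open Square
    ... | inj₂ ab | _       | _       | _       = inj₂ (Square-spanning-side sq (Spans-mono ⊆-∷ʳ ab))
    ... | _       | inj₂ bc | _       | _       = inj₂ (Square-spanning-side (Square-rotate sq) (Spans-mono ⊆-∷ʳ bc))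
    ... | _       | _       | inj₂ cd | _       =
      inj₂ (Square-spanning-side (Square-rotate (Square-rotate sq)) (Spans-mono ⊆-∷ʳ cd))
    ... | _       | _       | _       | inj₂ da =
      inj₂ (Square-spanning-side (Square-rotate (Square-rotate (Square-rotate sq))) (Spans-mono ⊆-∷ʳ da))
    ... | inj₁ ab | inj₁ bc | inj₁ cd | inj₁ da = inj₁ (Square-earlier ⊆-∷ʳ sq ab bc cd da)

  LongCycle : History n → Set
  LongCycle h = ∃[ k ] ∃[ c ] (5 ≤ k × Cycle h k c)

  SomeSquare : History n → Set
  SomeSquare h = ∃[ a ] ∃[ b ] ∃[ c ] ∃[ d ] Square h a b c d

  module _ {h : History n} {x y : Fin n} where

    Touches : Fin n → Set
    Touches u = Merged h u x ⊎ Merged h u y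

    Touches? : ∀ u → Dec (Touches u)
    Touches? u = Merged? h u x ⊎-dec Merged? h u y

    Touches-merged : ∀ {u w} → Touches u → Touches w → Merged (h ∷ʳ (x , y , true)) u w
    Touches-merged tu tw = m-trans (toy tu) (m-sym (toy tw))
      where
      toy : ∀ {u} → Touches u → Merged (h ∷ʳ (x , y , true)) u y
      toy (inj₁ ux) = m-trans (Merged-mono ⊆-∷ʳ ux) (m-step (∈-++⁺ʳ h (here refl)))
      toy (inj₂ uy) = Merged-mono ⊆-∷ʳ uy

    Merged-∷ʳ-positive-untouched : ∀ {u w} → ¬ Touches u → Merged (h ∷ʳ (x , y , true)) u w → Merged h u w
    Merged-∷ʳ-positive-untouched ¬tu m with Merged-∷ʳ-positive m
    ... | inj₁ u≈w             = u≈w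
    ... | inj₂ (inj₁ (ux , _)) = ⊥-elim (¬tu (inj₁ ux))
    ... | inj₂ (inj₂ (uy , _)) = ⊥-elim (¬tu (inj₂ uy))

    Adj-∷ʳ-positive-untouched : ∀ {u w} → ¬ Touches u → ¬ Touches w → Adj (h ∷ʳ (x , y , true)) u w → Adj h u w
    Adj-∷ʳ-positive-untouched ¬tu ¬tw (a , b , ua , wb , e) =
      a , b , Merged-∷ʳ-positive-untouched ¬tu ua , Merged-∷ʳ-positive-untouched ¬tw wb , Edge-∷ʳ-positive e

    Adj-∷ʳ-positive-touched : ∀ {u w} → ¬ Touches u → Touches w → Adj (h ∷ʳ (x , y , true)) u w → Adj h u x ⊎ Adj h u y
    Adj-∷ʳ-positive-touched {u} {w} ¬tu tw (a , b , ua , wb , e) =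
      touching (Merged-∷ʳ-positive wb)
        (Adj-resp-Merged (m-sym (Merged-∷ʳ-positive-untouched ¬tu ua)) m-refl (Edge⇒Adj (Edge-∷ʳ-positive e)))
      where
      touching : Merged h w b ⊎ Spans h x y w b → Adj h u b → Adj h u x ⊎ Adj h u y
      touching (inj₁ w≈b) u∼b =
        Sum.map (λ wx → Adj-resp-Merged m-refl (m-trans (m-sym w≈b) wx) u∼b)
                     (λ wy → Adj-resp-Merged m-refl (m-trans (m-sym w≈b) wy) u∼b) tw
      touching (inj₂ (inj₁ (_ , by))) u∼b = inj₂ (Adj-resp-Merged m-refl by u∼b)
      touching (inj₂ (inj₂ (_ , bx))) u∼b = inj₁ (Adj-resp-Merged m-refl bx u∼b)

    Touches-resp : ∀ {u w} → Merged h u w → Touches u → Touches w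
    Touches-resp u≈w = Sum.map (m-trans (m-sym u≈w)) (m-trans (m-sym u≈w))

    ¬Merged-∷ʳ-negative : ∀ {u w} → ¬ Merged h u w → ¬ Merged (h ∷ʳ (x , y , false)) u w
    ¬Merged-∷ʳ-negative ¬u≈w = ¬u≈w ∘ Merged-∷ʳ-negative

    ¬Adj-∷ʳ-negative : ∀ {u w} → ¬ Adj h u w → ¬ Touches w → ¬ Adj (h ∷ʳ (x , y , false)) u w
    ¬Adj-∷ʳ-negative ¬u∼w ¬tw u∼w with Adj-∷ʳ-negative u∼w
    ... | inj₁ u∼w′             = ¬u∼w u∼w′
    ... | inj₂ (inj₁ (_ , wy)) = ¬tw (inj₂ wy)
    ... | inj₂ (inj₂ (_ , wx)) = ¬tw (inj₁ wx)

    module _ {a b c d} (sq : Square (h ∷ʳ (x , y , true)) a b c d) (ta : Touches a) where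
      open Square sq

      untouched : ∀ {u} → ¬ Merged (h ∷ʳ (x , y , true)) a u → ¬ Touches u
      untouched a≠u tu = a≠u (Touches-merged ta tu)

      b-side : Adj h b x ⊎ Adj h b y
      b-side = Adj-∷ʳ-positive-touched (untouched a≠b) ta (Adj-sym a∼b)

      d-side : Adj h d x ⊎ Adj h d y
      d-side = Adj-∷ʳ-positive-touched (untouched a≠d) ta d∼a

      private
        ¬tb = untouched a≠b
        ¬tc = untouched a≠c
        ¬td = untouched a≠d

        b∼c′ : Adj h b c
        b∼c′ = Adj-∷ʳ-positive-untouched ¬tb ¬tc b∼c

        c∼d′ : Adj h c d
        c∼d′ = Adj-∷ʳ-positive-untouched ¬tc ¬td c∼d

        b≠c′ = b≠c ∘ Merged-mono ⊆-∷ʳ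
        b≠d′ = b≠d ∘ Merged-mono ⊆-∷ʳ
        c≠d′ = c≠d ∘ Merged-mono ⊆-∷ʳ
        b≁d′ = b≁d ∘ Adj-mono ⊆-∷ʳ

        c≁ : ∀ {z} → Touches z → ¬ Adj h c z
        c≁ tz c∼z = a≁c (Adj-sym (Adj-resp-Merged m-refl (Touches-merged tz ta) (Adj-mono ⊆-∷ʳ c∼z)))

        x≠ : ∀ {u} → ¬ Touches u → ¬ Merged h x u
        x≠ ¬tu x≈u = ¬tu (inj₁ (m-sym x≈u))

        ≠y : ∀ {u} → ¬ Touches u → ¬ Merged h u y
        ≠y ¬tu u≈y = ¬tu (inj₂ u≈y)

      corner-square : ∀ {z} → Touches z → Adj h b z → Adj h d z → SomeSquare h
      corner-square tz b∼z d∼z = _ , _ , _ , _ , record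
        { a≠b = λ z≈b → ¬tb (Touches-resp z≈b tz) ; a≠c = λ z≈c → ¬tc (Touches-resp z≈c tz)
        ; a≠d = λ z≈d → ¬td (Touches-resp z≈d tz)
        ; b≠c = b≠c′ ; b≠d = b≠d′ ; c≠d = c≠d′
        ; a∼b = Adj-sym b∼z ; b∼c = b∼c′ ; c∼d = c∼d′ ; d∼a = d∼z
        ; a≁c = c≁ tz ∘ Adj-sym ; b≁d = b≁d′ }

      pentagon : ¬ Merged h x y → Adj h b x → ¬ Adj h b y → Adj h d y → ¬ Adj h d x →
                 LongCycle (h ∷ʳ (x , y , false))
      pentagon ¬x≈y b∼x ¬b∼y d∼y ¬d∼x = 5 , _ , ≤-refl , InducedCycle⇒Cycle (InducedCycle-fromPairs {v = v} table)
        where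
        v = x V.∷ b V.∷ c V.∷ d V.∷ y V.∷ V.[]
        keep≠ = ¬Merged-∷ʳ-negative
        keep∼ = Adj-mono ⊆-∷ʳ
        keep≁ = ¬Adj-∷ʳ-negative

        table : OrderedPairs (CyclePair (h ∷ʳ (x , y , false)) 5 v)
        table =
          ( (λ { zero                   → edge (keep≠ (x≠ ¬tb)) (keep∼ (Adj-sym b∼x))
               ; (suc zero)             → non-edge (keep≠ (x≠ ¬tc)) (keep≁ (c≁ (inj₁ m-refl) ∘ Adj-sym) ¬tc)
               ; (suc (suc zero))       → non-edge (keep≠ (x≠ ¬td)) (keep≁ (¬d∼x ∘ Adj-sym) ¬td)
               ; (suc (suc (suc zero))) → edge (keep≠ ¬x≈y) (Spans⇒Adj-∷ʳ-negative (inj₁ (m-refl , m-refl))) })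
          , (λ { zero             → edge (keep≠ b≠c′) (keep∼ b∼c′)
               ; (suc zero)       → non-edge (keep≠ b≠d′) (keep≁ b≁d′ ¬td)
               ; (suc (suc zero)) → non-edge (keep≠ (≠y ¬tb)) (keep≁ (¬b∼y ∘ Adj-sym) ¬tb ∘ Adj-sym) })
          , (λ { zero       → edge (keep≠ c≠d′) (keep∼ c∼d′)
               ; (suc zero) → non-edge (keep≠ (≠y ¬tc)) (keep≁ (c≁ (inj₂ m-refl) ∘ Adj-sym) ¬tc ∘ Adj-sym) })
          , (λ { zero → edge (keep≠ (≠y ¬td)) (keep∼ d∼y) })
          , (λ ())
          , tt )

      split-corner : ¬ Merged h x y → Adj h b x → Adj h d y → SomeSquare h ⊎ LongCycle (h ∷ʳ (x , y , false))
      split-corner ¬x≈y b∼x d∼y with Adj? h b y | Adj? h d x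
      ... | yes b∼y | _       = inj₁ (corner-square (inj₂ m-refl) b∼y d∼y)
      ... | no _    | yes d∼x = inj₁ (corner-square (inj₁ m-refl) b∼x d∼x)
      ... | no ¬b∼y | no ¬d∼x = inj₂ (pentagon ¬x≈y b∼x ¬b∼y d∼y ¬d∼x)

    touched-corner : ∀ {a b c d} → ¬ Merged h x y → Square (h ∷ʳ (x , y , true)) a b c d → Touches a →
                     SomeSquare h ⊎ LongCycle (h ∷ʳ (x , y , false))
    touched-corner ¬x≈y sq ta with b-side sq ta | d-side sq ta
    ... | inj₁ b∼x | inj₁ d∼x = inj₁ (corner-square sq ta (inj₁ m-refl) b∼x d∼x)
    ... | inj₂ b∼y | inj₂ d∼y = inj₁ (corner-square sq ta (inj₂ m-refl) b∼y d∼y)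
    ... | inj₁ b∼x | inj₂ d∼y = split-corner sq ta ¬x≈y b∼x d∼y
    ... | inj₂ b∼y | inj₁ d∼x = split-corner (Square-reflect sq) ta ¬x≈y d∼x b∼y

    Square-∷ʳ-positive : ∀ {a b c d} → ¬ Merged h x y → Square (h ∷ʳ (x , y , true)) a b c d →
                         SomeSquare h ⊎ LongCycle (h ∷ʳ (x , y , false))
    Square-∷ʳ-positive {a} {b} {c} {d} ¬x≈y sq with Touches? a | Touches? b | Touches? c | Touches? d
    ... | yes ta | _      | _      | _      = touched-corner ¬x≈y sq ta
    ... | _      | yes tb | _      | _      = touched-corner ¬x≈y (Square-rotate sq) tb
    ... | _      | _      | yes tc | _      = touched-corner ¬x≈y (Square-rotate (Square-rotate sq)) tc
    ... | _      | _      | _      | yes td = touched-corner ¬x≈y (Square-rotate (Square-rotate (Square-rotate sq))) td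
    ... | no ¬ta | no ¬tb | no ¬tc | no ¬td = inj₁ (_ , _ , _ , _ , Square-earlier ⊆-∷ʳ sq
      (Adj-∷ʳ-positive-untouched ¬ta ¬tb a∼b) (Adj-∷ʳ-positive-untouched ¬tb ¬tc b∼c)
      (Adj-∷ʳ-positive-untouched ¬tc ¬td c∼d) (Adj-∷ʳ-positive-untouched ¬td ¬ta d∼a))
      where open Square sq

-- Finite searches

any<? : ∀ k {P : ℕ → Set} → (∀ i → Dec (P i)) → Dec (∃[ i ] (i < k × P i))
any<? k {P} P? = Dec.map′
  (λ (i , p) → toℕ i , toℕ<n i , p)
  (λ (i , i<k , p) → Fin.fromℕ< i<k , subst P (sym (Finₚ.toℕ-fromℕ< i<k)) p)
  (Finₚ.any? (P? ∘ toℕ))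

any-function? : ∀ {k m} {P : (Fin k → Fin m) → Set} → (∀ {f g} → f ≗ g → P f → P g) →
                (∀ f → Dec (P f)) → Dec (∃ P)
any-function? {zero} {P = P} resp P? = Dec.map′ ((λ ()) ,_) to (P? (λ ()))
  where
  to : ∃ P → P (λ ())
  to (f , pf) = resp (λ ()) pf
any-function? {suc k} resp P? = Dec.map′
  (λ (a , f , pf) → a V.∷ f , pf)
  (λ (f , pf) → f zero , f ∘ suc , resp (λ { zero → refl ; (suc i) → refl }) pf)
  (Finₚ.any? λ a → any-function? (λ f≗g → resp (λ { zero → refl ; (suc i) → f≗g i })) (P? ∘ (a V.∷_)))

module _ {n : ℕ} where

  InducedCycle? : ∀ h k v → Dec (InducedCycle {n} h k v)
  InducedCycle? h k v =
    Finₚ.all? (λ i → Finₚ.all? λ j → ¬? (i ≟ j) →-dec ¬? (Merged? h (v i) (v j)))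
    ×-dec Finₚ.all? (λ i → Finₚ.all? λ j → ¬? (i ≟ j) →-dec (cycAdj? k i j →-dec Adj? h (v i) (v j)))
    ×-dec Finₚ.all? (λ i → Finₚ.all? λ j → ¬? (i ≟ j) →-dec (Adj? h (v i) (v j) →-dec cycAdj? k i j))

  InducedCycle-resp : ∀ {h k v w} → v ≗ w → InducedCycle {n} h k v → InducedCycle h k w
  InducedCycle-resp {h} v≗w (distinct , adjacent , chordless) =
    (λ i j i≢j → subst₂ (λ a b → ¬ Merged h a b) (v≗w i) (v≗w j) (distinct i j i≢j)) ,
    (λ i j i≢j → subst₂ (Adj h) (v≗w i) (v≗w j) ∘ adjacent i j i≢j) ,
    (λ i j i≢j → chordless i j i≢j ∘ subst₂ (Adj h) (sym (v≗w i)) (sym (v≗w j)))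

-- Long cycles under a negatively answered query

module _ {n : ℕ} {h : History n} {x y : Fin n} (¬x≈y : ¬ Merged h x y) (¬x∼y : ¬ Adj h x y) where

  chord-cycle : ∀ {m c} → 3 ≤ m → Cycle (h ∷ʳ (x , y , false)) (suc m) c → Spans h x y (c 0) (c m) →
                LongCycle (h ∷ʳ (x , y , false)) ⊎ SquareOn (h ∷ʳ (x , y , false)) x y
  chord-cycle m≥3 C ends with m≤n⇒m<n∨m≡n m≥3
  ... | inj₁ m>3  = inj₁ (_ , _ , s≤s m>3 , C)
  ... | inj₂ refl =
    inj₂ (Square-spanning-side (Square-rotate (Square-rotate (Square-rotate sq))) (Spans-mono ⊆-∷ʳ (Spans-sym ends)))
    where sq = InducedCycle⇒Square (Cycle⇒InducedCycle C)

  chord-split : ∀ {k c a b} → Cycle h k c → 5 ≤ k → a < b → b < k → Spans h x y (c a) (c b) →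
                LongCycle (h ∷ʳ (x , y , false)) ⊎ SquareOn (h ∷ʳ (x , y , false)) x y
  chord-split {k} {c} {a} {b} C k≥5 a<b b<k ab =
    let m , c' , m≥3 , C' , ends = Cycle-chord C k≥5 a<b b<k ¬consecutive ab
    in  chord-cycle m≥3 C' ends
    where
    ¬consecutive : ¬ Consecutive k a b
    ¬consecutive cons with Cycle.adjacent C (<-trans a<b b<k) b<k (<⇒≢ a<b) cons
    ... | a∼b = [ (λ (ax , by) → ¬x∼y (Adj-resp-Merged ax by a∼b))
                , (λ (ay , bx) → ¬x∼y (Adj-sym (Adj-resp-Merged ay bx a∼b))) ]′ ab

  LongCycle-∷ʳ-negative : LongCycle h → LongCycle (h ∷ʳ (x , y , false)) ⊎ SquareOn (h ∷ʳ (x , y , false)) x y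
  LongCycle-∷ʳ-negative (k , c , k≥5 , C)
    with any<? k (λ i → Merged? h (c i) x) | any<? k (λ j → Merged? h (c j) y)
  ... | no ¬x | _ = inj₁ (k , c , k≥5 , Cycle-∷ʳ-negative C λ i<k j<k →
                      [ (λ (ix , _) → ¬x (_ , i<k , ix)) , (λ (_ , jx) → ¬x (_ , j<k , jx)) ]′)
  ... | _ | no ¬y = inj₁ (k , c , k≥5 , Cycle-∷ʳ-negative C λ i<k j<k →
                      [ (λ (_ , jy) → ¬y (_ , j<k , jy)) , (λ (iy , _) → ¬y (_ , i<k , iy)) ]′)
  ... | yes (i , i<k , ix) | yes (j , j<k , jy) with <-cmp i j
  ...   | tri< i<j _ _  = chord-split C k≥5 i<j j<k (inj₁ (ix , jy))
  ...   | tri> _ _ j<i  = chord-split C k≥5 j<i i<k (inj₂ (jy , ix))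
  ...   | tri≈ _ refl _ = ⊥-elim (¬x≈y (m-trans (m-sym ix) jy))

-- Runs

module _ {n : ℕ} (A : AC n) where

  G : Partition n → ℕ → History n
  G p t = run (strategy A) p t

  step-halted : ∀ {p} h → strategy A h ≡ nothing → step (strategy A) p h ≡ h
  step-halted h e with strategy A h
  step-halted h refl | nothing = refl

  step-queried : ∀ {p} h {x y} → strategy A h ≡ just (x , y) →
                 step (strategy A) p h ≡ h ∷ʳ (x , y , answer p x y)
  step-queried h e with strategy A h
  step-queried h refl | just _ = refl

  data Step (p : Partition n) (t : ℕ) : Set where
    halted  : strategy A (G p t) ≡ nothing → G p (suc t) ≡ G p t → Step p t
    queried : ∀ x y → strategy A (G p t) ≡ just (x , y) →
              G p (suc t) ≡ G p t ∷ʳ (x , y , answer p x y) → Step p t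

  step-view : ∀ p t → Step p t
  step-view p t with strategy A (G p t) in eq
  ... | nothing      = halted eq (step-halted (G p t) eq)
  ... | just (x , y) = queried x y eq (step-queried (G p t) eq)

  G-⊆-suc : ∀ p t → G p t ⊆ G p (suc t)
  G-⊆-suc p t with step-view p t
  ... | halted _ e      = subst (G p t ⊆_) (sym e) id
  ... | queried _ _ _ e = subst (G p t ⊆_) (sym e) ⊆-∷ʳ

  G-mono : ∀ p {t t'} → t ≤ t' → G p t ⊆ G p t'
  G-mono p t≤t' with m≤n⇒m<n∨m≡n t≤t'
  ... | inj₂ refl                 = id
  ... | inj₁ (s≤s {n = t''} t≤t'') = G-⊆-suc p t'' ∘ G-mono p t≤t''

  query-recorded : ∀ p t {x y} → strategy A (G p t) ≡ just (x , y) → (x , y , answer p x y) ∈ G p (suc t)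
  query-recorded p t q rewrite step-queried {p} (G p t) q = ∈-++⁺ʳ (G p t) (here refl)

  G-loopless : ∀ p t → Loopless (G p t)
  G-loopless p zero (_ , _ , _ , _ , inj₁ ())
  G-loopless p zero (_ , _ , _ , _ , inj₂ ())
  G-loopless p (suc t) with step-view p t
  ... | halted _ e rewrite e = G-loopless p t
  ... | queried x y q e rewrite e with answer p x y
  ...   | true  = Loopless-∷ʳ-positive (G-loopless p t) (proj₂ (validQ A p t x y q))
  ...   | false = Loopless-∷ʳ-negative (G-loopless p t) (proj₁ (validQ A p t x y q))

  step-cong : ∀ {p q} t → (∀ {x y} → strategy A (G p t) ≡ just (x , y) → answer q x y ≡ answer p x y) →
              step (strategy A) q (G p t) ≡ G p (suc t)
  step-cong {p} t same with step-view p t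
  ... | halted h e       = trans (step-halted _ h) (sym e)
  ... | queried x y q e = trans (step-queried _ q) (trans (cong (λ b → G p t ∷ʳ (x , y , b)) (same q)) (sym e))

  G-cong : ∀ {p p'} → p ≗ p' → ∀ t → G p' t ≡ G p t
  G-cong p≗p' zero    = refl
  G-cong {p} {p'} p≗p' (suc t) = trans (cong (step (strategy A) p') (G-cong p≗p' t))
    (step-cong t λ {x} {y} _ → cong₂ (λ a b → does (a ≟ b)) (sym (p≗p' x)) (sym (p≗p' y)))

  -- rep (G p T) is the partition whose blocks are the vertices of G p T: it replays the run up to time T
  -- and refuses every later merge.
  rep-answer : ∀ p T {x y b} → (x , y , b) ∈ G p T → answer (rep (G p T)) x y ≡ b
  rep-answer p T {b = true}  r = dec-true (_ ≟ _) (rep-complete (G p T) (m-step r))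
  rep-answer p T {b = false} r = dec-false (_ ≟ _) (G-loopless p T (Edge⇒Adj (inj₁ r)) ∘ rep-sound (G p T))

  G-rep : ∀ p {T} t → t ≤ T → G (rep (G p T)) t ≡ G p t
  G-rep p zero    _   = refl
  G-rep p {T} (suc t) t<T = trans (cong (step (strategy A) (rep (G p T))) (G-rep p t (<⇒≤ t<T)))
    (step-cong t λ q → rep-answer p T (G-mono p t<T (query-recorded p t q)))

  rep-answers-negatively : ∀ p {T u x y} → T ≤ u → strategy A (G (rep (G p T)) u) ≡ just (x , y) →
                           answer (rep (G p T)) x y ≡ false
  rep-answers-negatively p {T} {u} {x} {y} T≤u q = dec-false (_ ≟ _) λ e →
    proj₁ (validQ A (rep (G p T)) u x y q)
      (Merged-mono (G-mono (rep (G p T)) T≤u)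
        (subst (λ h → Merged h x y) (sym (G-rep p T ≤-refl)) (rep-sound (G p T) e)))

  G-halted : ∀ p t → strategy A (G p t) ≡ nothing → ∀ d → G p (d + t) ≡ G p t
  G-halted p t h zero    = refl
  G-halted p t h (suc d) = trans (step-halted _ (trans (cong (strategy A) (G-halted p t h d)) h)) (G-halted p t h d)

  queried-before : ∀ p {s t z} → s ≤ t → strategy A (G p t) ≡ just z → ∃[ z' ] strategy A (G p s) ≡ just z'
  queried-before p {s} s≤t q with strategy A (G p s) in h
  ... | just z' = z' , refl
  ... | nothing with m≤n⇒∃[o]m+o≡n s≤t
  ...   | d , refl with trans (sym q) (trans (cong (strategy A ∘ G p) (+-comm s d))
                                       (trans (cong (strategy A) (G-halted p s h d)) h))
  ...     | ()

  not-requeried : ∀ p {s s' z} → s < s' → strategy A (G p s) ≡ just z → strategy A (G p s') ≢ just z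
  not-requeried p {s} {s'} {x , y} s<s' q q′ with validQ A p s' x y q′ | G-mono p s<s' (query-recorded p s q)
  ... | ¬x≈y , ¬x∼y | r with answer p x y
  ...   | true  = ¬x≈y (m-step r)
  ...   | false = ¬x∼y (Edge⇒Adj (inj₁ r))

  queries-bounded : ∀ p t {z} → strategy A (G p t) ≡ just z → t < n * n
  queries-bounded p t q with t ℕ.<? n * n
  ... | yes t<n² = t<n²
  ... | no t≮n²  = ⊥-elim (repeated (Finₚ.pigeonhole (s≤s (≮⇒≥ t≮n²)) (uncurry Fin.combine ∘ proj₁ ∘ before)))
    where
    before : (i : Fin (suc t)) → ∃[ z ] strategy A (G p (toℕ i)) ≡ just z
    before i = queried-before p (Finₚ.toℕ≤pred[n] i) q

    repeated : ¬ (∃[ i ] ∃[ j ] (i Fin.< j ×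
                  uncurry Fin.combine (proj₁ (before i)) ≡ uncurry Fin.combine (proj₁ (before j))))
    repeated (i , j , i<j , same) with Finₚ.combine-injective _ _ _ _ same
    ... | eq₁ , eq₂ = not-requeried p i<j (proj₂ (before i))
                        (trans (proj₂ (before j)) (cong just (sym (cong₂ _,_ eq₁ eq₂))))

  CreatesSquare : Partition n → ℕ → Fin n → Fin n → (Fin 4 → Fin n) → Set
  CreatesSquare p t x y v =
    strategy A (G p t) ≡ just (x , y) × p x ≢ p y × InducedCycle (G p (suc t)) 4 v ×
    Merged (G p (suc t)) (v zero) x × Merged (G p (suc t)) (v (suc zero)) y

  SquareCreated : Set
  SquareCreated = ∃[ p ] ∃[ t ] ∃[ x ] ∃[ y ] ∃[ v ] CreatesSquare p t x y v

  G-negative : ∀ p t {x y} → strategy A (G p t) ≡ just (x , y) → answer p x y ≡ false →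
               G p (suc t) ≡ G p t ∷ʳ (x , y , false)
  G-negative p t q refused = trans (step-queried (G p t) q) (cong (λ b → G p t ∷ʳ (_ , _ , b)) refused)

  SquareOn⇒SquareCreated : ∀ p t {x y} → strategy A (G p t) ≡ just (x , y) → answer p x y ≡ false →
                    SquareOn (G p t ∷ʳ (x , y , false)) x y → SquareCreated
  SquareOn⇒SquareCreated p t {x} {y} q refused (_ , _ , _ , _ , sq , ax , by) =
    p , t , x , y , _ , q , px≢py ,
    subst (λ h → InducedCycle h 4 _ × Merged h _ x × Merged h _ y) (sym (G-negative p t q refused))
      (Square⇒InducedCycle sq , ax , by)
    where
    px≢py : p x ≢ p y
    px≢py e = case trans (sym refused) (dec-true (p x ≟ p y) e) of λ ()

-- Chordality when no refused query creates a square

  module _ (¬created : ¬ SquareCreated) where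

    LongCycle-step : ∀ p {T u} → T ≤ u → LongCycle (G (rep (G p T)) u) → LongCycle (G (rep (G p T)) (suc u))
    LongCycle-step p {T} {u} T≤u L with step-view (rep (G p T)) u
    ... | halted _ e      = subst LongCycle (sym e) L
    ... | queried x y q _ =
      [ subst LongCycle (sym (G-negative _ u q refused)) , ⊥-elim ∘ ¬created ∘ SquareOn⇒SquareCreated _ u q refused ]′
        (LongCycle-∷ʳ-negative (proj₁ (validQ A _ u x y q)) (proj₂ (validQ A _ u x y q)) L)
      where refused = rep-answers-negatively p T≤u q

    LongCycle-steps : ∀ p {T u} → T ≤ u → LongCycle (G (rep (G p T)) u) → ∀ d → LongCycle (G (rep (G p T)) (d + u))
    LongCycle-steps p T≤u L zero    = L
    LongCycle-steps p T≤u L (suc d) = LongCycle-step p (m≤n⇒m≤o+n d T≤u) (LongCycle-steps p T≤u L d)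

    no-long-cycle : ∀ p {T u} → T ≤ u → ¬ LongCycle (G (rep (G p T)) u)
    no-long-cycle p {T} {u} T≤u L with LongCycle-steps p T≤u L (n * n)
    ... | k , c , k≥5 , C = Complete-¬Cycle (stopsIff₁ A (rep (G p T)) (n * n + u) halts) (<⇒≤ k≥5) C
      where
      halts : strategy A (G (rep (G p T)) (n * n + u)) ≡ nothing
      halts with strategy A (G (rep (G p T)) (n * n + u)) in q
      ... | nothing = refl
      ... | just _  = ⊥-elim (m+n≮m (n * n) u (queries-bounded _ _ q))

    no-square : ∀ p t {a b c d} → ¬ Square (G p t) a b c d
    no-square p zero    sq with Square.a∼b sq
    ... | _ , _ , _ , _ , inj₁ ()
    ... | _ , _ , _ , _ , inj₂ ()
    no-square p (suc t) sq with step-view p t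
    ... | halted _ e = no-square p t (subst (λ h → Square h _ _ _ _) e sq)
    ... | queried x y q e with answer p x y in ans
    ...   | true  = [ (λ (_ , _ , _ , _ , sq′) → no-square p t sq′)
                    , (λ L → no-long-cycle p (n≤1+n t) (subst LongCycle (sym G-merge-refused) L)) ]′
                      (Square-∷ʳ-positive ¬x≈y (subst (λ h → Square h _ _ _ _) e sq))
      where
      ¬x≈y = proj₁ (validQ A p t x y q)
      q′ : strategy A (G (rep (G p t)) t) ≡ just (x , y)
      q′ = trans (cong (strategy A) (G-rep p t ≤-refl)) q
      G-merge-refused : G (rep (G p t)) (suc t) ≡ G p t ∷ʳ (x , y , false)
      G-merge-refused = trans (G-negative _ t q′ (rep-answers-negatively p {T = t} ≤-refl q′))
                              (cong (_∷ʳ (x , y , false)) (G-rep p t ≤-refl))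
    ...   | false = [ no-square p t , ¬created ∘ SquareOn⇒SquareCreated p t q ans ]′
                      (Square-∷ʳ-negative (subst (λ h → Square h _ _ _ _) e sq))

    chordal : Chordal A
    chordal p t k k≥4 v cycle with m≤n⇒m<n∨m≡n k≥4
    ... | inj₂ refl        = no-square p t (InducedCycle⇒Square cycle)
    ... | inj₁ k≥5@(s≤s _) =
      no-long-cycle p {T = t} ≤-refl
        (subst LongCycle (sym (G-rep p t ≤-refl)) (k , _ , k≥5 , InducedCycle⇒Cycle cycle))

  CreatesSquare? : ∀ p t x y v → Dec (CreatesSquare p t x y v)
  CreatesSquare? p t x y v =
    Maybeₚ.≡-dec (Productₚ.≡-dec _≟_ _≟_) (strategy A (G p t)) (just (x , y)) ×-dec ¬? (p x ≟ p y)
    ×-dec InducedCycle? _ 4 v ×-dec Merged? _ (v zero) x ×-dec Merged? _ (v (suc zero)) y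

  CreatesSquare-respˡ : ∀ {p p' t x y v} → p ≗ p' → CreatesSquare p t x y v → CreatesSquare p' t x y v
  CreatesSquare-respˡ {p} {p'} {t} {x} {y} {v} p≗p' (q , px≢py , rest) =
    trans (cong (strategy A) (G-cong p≗p' t)) q ,
    (λ e → px≢py (trans (p≗p' x) (trans e (sym (p≗p' y))))) ,
    subst (λ h → InducedCycle h 4 v × Merged h (v zero) x × Merged h (v (suc zero)) y)
          (sym (G-cong p≗p' (suc t))) rest

  CreatesSquare-respʳ : ∀ {p t x y v w} → v ≗ w → CreatesSquare p t x y v → CreatesSquare p t x y w
  CreatesSquare-respʳ {p} {t} {x} {y} v≗w (q , px≢py , cycle , v₀x , v₁y) =
    q , px≢py , InducedCycle-resp v≗w cycle ,
    subst (λ a → Merged (G p (suc t)) a x) (v≗w zero) v₀x ,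
    subst (λ b → Merged (G p (suc t)) b y) (v≗w (suc zero)) v₁y

  SquareCreated? : Dec SquareCreated
  SquareCreated? =
    any-function? (λ p≗p' (t , x , y , v , c) → t , x , y , v , CreatesSquare-respˡ {t = t} p≗p' c) λ p →
    Dec.map′ (λ (t , _ , c) → t , c)
             (λ (t , c@(_ , _ , _ , q , _)) → t , queries-bounded p t q , c)
      (any<? (n * n) λ t → Finₚ.any? λ x → Finₚ.any? λ y →
        any-function? (CreatesSquare-respʳ {p} {t}) (CreatesSquare? p t x y))

lemma4 : ∀ {n} (A : AC n) → ¬ Chordal A →
    ∃[ p ] ∃[ t ] ∃[ x ] ∃[ y ] ∃[ v ]
    (strategy A (run (strategy A) p t) ≡ just (x , y) ×
    p x ≢ p y ×
    InducedCycle (run (strategy A) p (suc t)) 4 v ×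
    Merged (run (strategy A) p (suc t)) (v zero) x ×
    Merged (run (strategy A) p (suc t)) (v (suc zero)) y)
lemma4 A ¬chordal = decidable-stable (SquareCreated? A) (¬chordal ∘ chordal A)
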